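{- For every integer $h\ge3$ there are $\delta_0=\delta_0(h)>0$ and $\beta=\beta(h)>0$ such that for every $\delta<\delta_0$ there is a graph $R=R(h,\delta)$ with the following properties: (1) $V(R)=V_1\cup\dots\cup V_h$ (disjoint) and each $V_i$ is an independent set; (2) $|V(R)|\ge(1/\delta)^{\beta\log(1/\delta)}$; (3) $E(R)$ is the union of at least $\delta|V(R)|^2$ pairwise edge-disjoint cliques on $h$ vertices; (4) for every $3\le t\le h$ and every sequence $1\le i_1<i_2<\dots<i_t\le h$, $R$ contains at most $|V(R)|^2$ (not necessarily induced) cycles of the form $v_{i_1}v_{i_2}\dots v_{i_t}v_{i_1}$ with $v_{i_j}\in V_{i_j}$.
   Formalization: The parameter δ ranges over the positive rationals. -}

module Defs where

open import Data.Nat as ℕ using (ℕ; zero; suc)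
open import Data.Integer using (+_)
open import Data.Rational using (ℚ; _*_; _/_; 1ℚ; _≤_; _<_)
open import Data.Bool using (Bool; true; false; _∧_)
open import Data.Fin using (Fin; zero; suc; _≟_)
import Data.Fin as Fin
open import Data.Vec using (Vec; []; _∷_; lookup)
open import Data.List using (List; []; _∷_; length; filterᵇ; concatMap; allFin)
open import Data.Product using (Σ; ∃; ∃-syntax; _×_; _,_)
open import Relation.Nullary using (¬_; ⌊_⌋)
open import Relation.Binary.PropositionalEquality using (_≡_; _≢_)

ℕ→ℚ : ℕ → ℚ
ℕ→ℚ n = + n / 1

_^ℚ_ : ℚ → ℕ → ℚ
q ^ℚ zero  = 1ℚ
q ^ℚ suc k = q * (q ^ℚ k)

record Graph (n : ℕ) : Set where
  field
    adj    : Fin n → Fin n → Bool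
    sym    : ∀ u v → adj u v ≡ adj v u
    irrefl : ∀ v → adj v v ≡ false
open Graph public

IsClique : ∀ {n} → Graph n → (h : ℕ) → (Fin h → Fin n) → Set
IsClique G h K = (∀ i j → i ≢ j → K i ≢ K j) × (∀ i j → i ≢ j → adj G (K i) (K j) ≡ true)

IsEdgeDisjointCliqueDecomposition : ∀ {n} → Graph n → (h m : ℕ) → (Fin m → Fin h → Fin n) → Set
IsEdgeDisjointCliqueDecomposition G h m K =
  (∀ k → IsClique G h (K k)) ×
  (∀ u v → adj G u v ≡ true → ∃[ k ] ∃[ i ] ∃[ j ] (K k i ≡ u × K k j ≡ v)) ×
  (∀ k l → k ≢ l → ∀ i j i' j' → i ≢ j → ¬ (K k i ≡ K l i' × K k j ≡ K l j'))

allVecs : (n t : ℕ) → List (Vec (Fin n) t)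
allVecs n zero    = [] ∷ []
allVecs n (suc t) = concatMap (λ v → Data.List.map (_∷ v) (allFin n)) (allVecs n t)

closesAt : ∀ {n t} → Graph n → Fin n → Vec (Fin n) t → Bool
closesAt G first []           = true
closesAt G first (x ∷ [])     = adj G x first
closesAt G first (x ∷ y ∷ xs) = adj G x y ∧ closesAt G first (y ∷ xs)

inPartsᵇ : ∀ {n h t} → (Fin n → Fin h) → (Fin t → Fin h) → Vec (Fin n) t → Bool
inPartsᵇ part s []       = true
inPartsᵇ part s (x ∷ xs) = ⌊ part x ≟ s zero ⌋ ∧ inPartsᵇ part (λ j → s (suc j)) xs

isCycleᵇ : ∀ {n h t} → Graph n → (Fin n → Fin h) → (Fin t → Fin h) → Vec (Fin n) t → Bool
isCycleᵇ G part s []       = false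
isCycleᵇ G part s (x ∷ xs) = inPartsᵇ part s (x ∷ xs) ∧ closesAt G x (x ∷ xs)

cycleCount : ∀ {n h} → Graph n → (Fin n → Fin h) → (t : ℕ) → (Fin t → Fin h) → ℕ
cycleCount {n} G part t s = length (filterᵇ (isCycleᵇ G part s) (allVecs n t))

StrictlyIncreasing : ∀ {h t} → (Fin t → Fin h) → Set
StrictlyIncreasing s = ∀ i j → i Fin.< j → s i Fin.< s j

module Submission where

-- Construction (Behrend type).  For a direction y ∈ [d]ᴷ let ŷ = (‖y‖², y) be its
-- lift to the paraboloid.  For every base point x of a box and every direction y,
-- the vertices (i, x + i·ŷ), i < h, form an h-clique; R is the union of these
-- cliques.  Two vertices in different parts fix the line, hence x and y, so the
-- cliques are edge-disjoint.  Along a cycle through parts i₁ < … < iₜ the edge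
-- steps are (iⱼ₊₁ − iⱼ)·ŷⱼ and the closing edge is (iₜ − i₁)·ŷ, so ŷ is a weighted
-- average of the ŷⱼ; strict convexity of ‖·‖² forces every yⱼ = y, and the cycle is
-- determined by its first edge: at most |V(R)|² cycles.

module Development where

  open import Defs hiding (sym)
  open import Data.Nat as ℕ using (ℕ; zero; suc; z≤n; s≤s; _+_; _*_; _∸_; _^_; ∣_-_∣; _≤_; _<_; >-nonZero)
  open import Data.Nat.Properties
  open import Data.Nat.DivMod using (_/_; m/n*n≤m; m≡m%n+[m/n]*n; m%n<n)
  open import Data.Nat.Coprimality as Coprime using (Coprime; 1-coprimeTo)
  open import Data.Nat.Tactic.RingSolver using (solve-∀)
  import Data.Integer as ℤ
  import Data.Integer.Properties as ℤ
  open import Data.Rational as ℚ using (ℚ; mkℚ; 0ℚ; 1ℚ; toℚᵘ; Positive)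
  open import Data.Rational.Properties as ℚ using (normalize-coprime; toℚᵘ-injective; toℚᵘ-homo-*; toℚᵘ-cancel-≤)
  open import Data.Rational.Unnormalised as ℚᵘ using (mkℚᵘ)
  import Data.Rational.Unnormalised.Properties as ℚᵘ
  open import Data.Fin as Fin using (Fin; zero; suc; toℕ; fromℕ<; fromℕ; inject₁; combine; remQuot; finToFun; funToFin)
  open import Data.Fin.Properties as Fin
    using (toℕ<n; toℕ-injective; toℕ-fromℕ<; remQuot-combine; combine-remQuot; combine-injective; funToFin-finToFin; finToFun-funToFin)
  open import Data.Fin.Induction using (<-weakInduction)
  open import Data.Vec as Vec using (Vec; []; _∷_; lookup; tabulate)
  open import Data.Vec.Properties as Vec using (tabulate∘lookup; tabulate-cong)
  open import Data.List as List using (List; []; _∷_; length; filterᵇ; concat; allFin)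
  import Data.List.Relation.Unary.All as All
  open import Data.List.Relation.Unary.Unique.Propositional using (Unique; []; _∷_)
  import Data.List.Relation.Unary.Unique.Propositional.Properties as Unique
  open import Data.List.Membership.Propositional using (_∈_)
  open import Data.List.Membership.Propositional.Properties using (∈-lookup; ∈-filter⁻; ∈-map⁻; ∈-concat⁻′)
  open import Data.Product using (Σ; ∃-syntax; _×_; _,_; proj₁; proj₂; uncurry)
  open import Data.Product.Properties using (×-≡,≡→≡)
  open import Data.Sum using (_⊎_; inj₁; inj₂; [_,_]′)
  open import Data.Bool using (Bool; true; false; T)
  open import Data.Bool.Properties using (∨-comm; T-≡; T-∧)
  open import Data.Empty using (⊥; ⊥-elim)
  open import Function using (_∘_; id)
  open import Function.Bundles using (Equivalence)
  open import Relation.Nullary using (¬_; Dec; yes; no; does; _×-dec_; _⊎-dec_)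
  open import Relation.Nullary.Decidable using (T?; dec-true; dec-false)
  open import Relation.Binary.Definitions using (Tri; tri<; tri≈; tri>)
  open import Relation.Binary.PropositionalEquality
  open import Algebra.Bundles using (CommutativeMonoid)
  open import Algebra.Properties.CommutativeSemigroup
    (CommutativeMonoid.commutativeSemigroup ℚ.*-1-commutativeMonoid) using (interchange)
  open import Algebra.Properties.Semiring.Sum +-*-semiring
    using (sum; ∑-distrib-+; ∑-comm; *-distribˡ-sum; *-distribʳ-sum; sum-cong-≗)

  sum≡0⇒≡0 : ∀ {n} (f : Fin n → ℕ) → sum f ≡ 0 → ∀ i → f i ≡ 0
  sum≡0⇒≡0 f eq zero    = m+n≡0⇒m≡0 (f zero) eq
  sum≡0⇒≡0 f eq (suc i) = sum≡0⇒≡0 (f ∘ suc) (m+n≡0⇒n≡0 (f zero) eq) i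

  sum-≤ : ∀ {n} {f : Fin n → ℕ} {B} → (∀ i → f i ≤ B) → sum f ≤ n * B
  sum-≤ {zero}  f≤B = z≤n
  sum-≤ {suc n} f≤B = +-mono-≤ (f≤B zero) (sum-≤ (f≤B ∘ suc))

  telescope : ∀ {n} (f : Fin (suc n) → ℕ) (g : Fin n → ℕ) →
              (∀ j → f (suc j) ≡ f (inject₁ j) + g j) → f (fromℕ n) ≡ f zero + sum g
  telescope {zero}  f g step = sym (+-identityʳ (f zero))
  telescope {suc n} f g step = begin
    f (fromℕ (suc n))                 ≡⟨ telescope (f ∘ suc) (g ∘ suc) (step ∘ suc) ⟩
    f (suc zero) + sum (g ∘ suc)      ≡⟨ cong (_+ sum (g ∘ suc)) (step zero) ⟩
    f zero + g zero + sum (g ∘ suc)   ≡⟨ +-assoc (f zero) (g zero) _ ⟩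
    f zero + sum g                    ∎
    where open ≡-Reasoning

  dist-sq-≤ : ∀ {a b} → a ≤ b → ∣ a - b ∣ * ∣ a - b ∣ + 2 * (a * b) ≡ a * a + b * b
  dist-sq-≤ {a} {b} a≤b =
    subst (λ b → ∣ a - b ∣ * ∣ a - b ∣ + 2 * (a * b) ≡ a * a + b * b) (m+[n∸m]≡n a≤b) (shifted a (b ∸ a))
    where
    expand : ∀ a k → k * k + 2 * (a * (a + k)) ≡ a * a + (a + k) * (a + k)
    expand = solve-∀
    shifted : ∀ a k → ∣ a - (a + k) ∣ * ∣ a - (a + k) ∣ + 2 * (a * (a + k)) ≡ a * a + (a + k) * (a + k)
    shifted a k rewrite ∣m-m+n∣≡n a k = expand a k

  dist-sq : ∀ a b → ∣ a - b ∣ * ∣ a - b ∣ + 2 * (a * b) ≡ a * a + b * b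
  dist-sq a b with ≤-total a b
  ... | inj₁ a≤b = dist-sq-≤ a≤b
  ... | inj₂ b≤a = begin
    ∣ a - b ∣ * ∣ a - b ∣ + 2 * (a * b) ≡⟨ cong₂ (λ d p → d * d + 2 * p) (∣-∣-comm a b) (*-comm a b) ⟩
    ∣ b - a ∣ * ∣ b - a ∣ + 2 * (b * a) ≡⟨ dist-sq-≤ b≤a ⟩
    b * b + a * a                       ≡⟨ +-comm (b * b) (a * a) ⟩
    a * a + b * b                       ∎
    where open ≡-Reasoning

  ‖_‖² : ∀ {K} → (Fin K → ℕ) → ℕ
  ‖ y ‖² = sum (λ c → y c * y c)

  ⟨_,_⟩ : ∀ {K} → (Fin K → ℕ) → (Fin K → ℕ) → ℕ
  ⟨ y , b ⟩ = sum (λ c → y c * b c)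

  dist² : ∀ {K} → (Fin K → ℕ) → (Fin K → ℕ) → ℕ
  dist² y b = sum (λ c → ∣ y c - b c ∣ * ∣ y c - b c ∣)

  polarisation : ∀ {K} (y b : Fin K → ℕ) → dist² y b + 2 * ⟨ y , b ⟩ ≡ ‖ y ‖² + ‖ b ‖²
  polarisation y b = begin
    dist² y b + 2 * ⟨ y , b ⟩
      ≡⟨ cong (dist² y b +_) (*-distribˡ-sum 2 (λ c → y c * b c)) ⟩
    dist² y b + sum (λ c → 2 * (y c * b c))
      ≡⟨ ∑-distrib-+ (λ c → ∣ y c - b c ∣ * ∣ y c - b c ∣) (λ c → 2 * (y c * b c)) ⟨
    sum (λ c → ∣ y c - b c ∣ * ∣ y c - b c ∣ + 2 * (y c * b c))
      ≡⟨ sum-cong-≗ (λ c → dist-sq (y c) (b c)) ⟩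
    sum (λ c → y c * y c + b c * b c)
      ≡⟨ ∑-distrib-+ (λ c → y c * y c) (λ c → b c * b c) ⟩
    ‖ y ‖² + ‖ b ‖² ∎
    where open ≡-Reasoning

  weighted-polarisation : ∀ {t K} (Δ : Fin t → ℕ) (Y : Fin t → Fin K → ℕ) (b : Fin K → ℕ) →
    sum (λ j → Δ j * dist² (Y j) b) + 2 * sum (λ j → Δ j * ⟨ Y j , b ⟩) ≡
    sum (λ j → Δ j * ‖ Y j ‖²) + sum Δ * ‖ b ‖²
  weighted-polarisation Δ Y b = begin
    sum (λ j → Δ j * dist² (Y j) b) + 2 * sum (λ j → Δ j * ⟨ Y j , b ⟩)
      ≡⟨ cong (sum (λ j → Δ j * dist² (Y j) b) +_) (*-distribˡ-sum 2 (λ j → Δ j * ⟨ Y j , b ⟩)) ⟩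
    sum (λ j → Δ j * dist² (Y j) b) + sum (λ j → 2 * (Δ j * ⟨ Y j , b ⟩))
      ≡⟨ ∑-distrib-+ (λ j → Δ j * dist² (Y j) b) (λ j → 2 * (Δ j * ⟨ Y j , b ⟩)) ⟨
    sum (λ j → Δ j * dist² (Y j) b + 2 * (Δ j * ⟨ Y j , b ⟩))
      ≡⟨ sum-cong-≗ (λ j → per-term (Δ j) (Y j)) ⟩
    sum (λ j → Δ j * ‖ Y j ‖² + Δ j * ‖ b ‖²)
      ≡⟨ ∑-distrib-+ (λ j → Δ j * ‖ Y j ‖²) (λ j → Δ j * ‖ b ‖²) ⟩
    sum (λ j → Δ j * ‖ Y j ‖²) + sum (λ j → Δ j * ‖ b ‖²)
      ≡⟨ cong (sum (λ j → Δ j * ‖ Y j ‖²) +_) (*-distribʳ-sum ‖ b ‖² Δ) ⟨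
    sum (λ j → Δ j * ‖ Y j ‖²) + sum Δ * ‖ b ‖² ∎
    where
    open ≡-Reasoning
    swap-weights : ∀ x y z → x * (y * z) ≡ y * (x * z)
    swap-weights = solve-∀
    per-term : ∀ w y → w * dist² y b + 2 * (w * ⟨ y , b ⟩) ≡ w * ‖ y ‖² + w * ‖ b ‖²
    per-term w y = begin
      w * dist² y b + 2 * (w * ⟨ y , b ⟩)  ≡⟨ cong (w * dist² y b +_) (swap-weights 2 w ⟨ y , b ⟩) ⟩
      w * dist² y b + w * (2 * ⟨ y , b ⟩)  ≡⟨ *-distribˡ-+ w _ _ ⟨
      w * (dist² y b + 2 * ⟨ y , b ⟩)      ≡⟨ cong (w *_) (polarisation y b) ⟩
      w * (‖ y ‖² + ‖ b ‖²)                ≡⟨ *-distribˡ-+ w _ _ ⟩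
      w * ‖ y ‖² + w * ‖ b ‖²              ∎

  weighted-inner-product : ∀ {t K} (Δ : Fin t → ℕ) (Y : Fin t → Fin K → ℕ) (b : Fin K → ℕ) →
    (∀ c → sum (λ j → Δ j * Y j c) ≡ sum Δ * b c) →
    sum (λ j → Δ j * ⟨ Y j , b ⟩) ≡ sum Δ * ‖ b ‖²
  weighted-inner-product Δ Y b centroid = begin
    sum (λ j → Δ j * ⟨ Y j , b ⟩)
      ≡⟨ sum-cong-≗ (λ j → *-distribˡ-sum (Δ j) (λ c → Y j c * b c)) ⟩
    sum (λ j → sum (λ c → Δ j * (Y j c * b c)))
      ≡⟨ ∑-comm (λ j c → Δ j * (Y j c * b c)) ⟩
    sum (λ c → sum (λ j → Δ j * (Y j c * b c)))
      ≡⟨ sum-cong-≗ (λ c → sum-cong-≗ (λ j → sym (*-assoc (Δ j) (Y j c) (b c)))) ⟩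
    sum (λ c → sum (λ j → Δ j * Y j c * b c))
      ≡⟨ sum-cong-≗ (λ c → *-distribʳ-sum (b c) (λ j → Δ j * Y j c)) ⟨
    sum (λ c → sum (λ j → Δ j * Y j c) * b c)
      ≡⟨ sum-cong-≗ (λ c → cong (_* b c) (centroid c)) ⟩
    sum (λ c → sum Δ * b c * b c)
      ≡⟨ sum-cong-≗ (λ c → *-assoc (sum Δ) (b c) (b c)) ⟩
    sum (λ c → sum Δ * (b c * b c))
      ≡⟨ *-distribˡ-sum (sum Δ) (λ c → b c * b c) ⟨
    sum Δ * ‖ b ‖² ∎
    where open ≡-Reasoning

  -- By the two identities above the
  -- weighted spread Σⱼ Δⱼ‖Yⱼ − b‖² vanishes, so each Yⱼ − b does.
  paraboloid-rigidity : ∀ {t K} (Δ : Fin t → ℕ) (Y : Fin t → Fin K → ℕ) (b : Fin K → ℕ) →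
    (∀ j → 0 < Δ j) →
    (∀ c → sum (λ j → Δ j * Y j c) ≡ sum Δ * b c) →
    sum (λ j → Δ j * ‖ Y j ‖²) ≡ sum Δ * ‖ b ‖² →
    ∀ j c → Y j c ≡ b c
  paraboloid-rigidity Δ Y b Δ>0 centroid height j c =
    ∣m-n∣≡0⇒m≡n (square≡0 (sum≡0⇒≡0 _ distance≡0 c))
    where
    open ≡-Reasoning
    square≡0 : ∀ {m} → m * m ≡ 0 → m ≡ 0
    square≡0 {m} eq = [ id , id ]′ (m*n≡0⇒m≡0∨n≡0 m eq)
    spread : sum (λ j → Δ j * dist² (Y j) b) + 2 * (sum Δ * ‖ b ‖²) ≡ 0 + 2 * (sum Δ * ‖ b ‖²)
    spread = begin
      sum (λ j → Δ j * dist² (Y j) b) + 2 * (sum Δ * ‖ b ‖²)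
        ≡⟨ cong (λ z → sum (λ j → Δ j * dist² (Y j) b) + 2 * z) (weighted-inner-product Δ Y b centroid) ⟨
      sum (λ j → Δ j * dist² (Y j) b) + 2 * sum (λ j → Δ j * ⟨ Y j , b ⟩)
        ≡⟨ weighted-polarisation Δ Y b ⟩
      sum (λ j → Δ j * ‖ Y j ‖²) + sum Δ * ‖ b ‖²
        ≡⟨ cong (_+ sum Δ * ‖ b ‖²) height ⟩
      sum Δ * ‖ b ‖² + sum Δ * ‖ b ‖²
        ≡⟨ cong (sum Δ * ‖ b ‖² +_) (+-identityʳ (sum Δ * ‖ b ‖²)) ⟨
      0 + 2 * (sum Δ * ‖ b ‖²) ∎
    distance≡0 : dist² (Y j) b ≡ 0
    distance≡0 = [ (λ Δ≡0 → ⊥-elim (<-irrefl (sym Δ≡0) (Δ>0 j))) , id ]′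
      (m*n≡0⇒m≡0∨n≡0 (Δ j) (sum≡0⇒≡0 _ (+-cancelʳ-≡ _ _ 0 spread) j))

  ^-distribʳ-* : ∀ a b k → (a * b) ^ k ≡ a ^ k * b ^ k
  ^-distribʳ-* a b zero    = refl
  ^-distribʳ-* a b (suc k) = trans (cong (a * b *_) (^-distribʳ-* a b k)) (regroup a b (a ^ k) (b ^ k))
    where
    regroup : ∀ a b x y → a * b * (x * y) ≡ a * x * (b * y)
    regroup = solve-∀

  n<2^n : ∀ n → n < 2 ^ n
  n<2^n zero    = s≤s z≤n
  n<2^n (suc n) = ≤-trans (s≤s (n<2^n n))
    (≤-trans (+-monoˡ-≤ (2 ^ n) (m^n>0 2 n)) (≤-reflexive (cong (2 ^ n +_) (sym (+-identityʳ (2 ^ n))))))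

  line-step : ∀ x y {i j} → i ≤ j → x + j * y ≡ (x + i * y) + (j ∸ i) * y
  line-step x y {i} {j} i≤j = begin
    x + j * y                 ≡⟨ cong (λ k → x + k * y) (m+[n∸m]≡n i≤j) ⟨
    x + (i + (j ∸ i)) * y     ≡⟨ cong (x +_) (*-distribʳ-+ y i (j ∸ i)) ⟩
    x + (i * y + (j ∸ i) * y) ≡⟨ +-assoc x (i * y) _ ⟨
    x + i * y + (j ∸ i) * y   ∎
    where open ≡-Reasoning

  +-*-cancelˡ : ∀ x {Δ a b} → 0 < Δ → x + Δ * a ≡ x + Δ * b → a ≡ b
  +-*-cancelˡ x {Δ} {a} {b} 0<Δ eq = *-cancelˡ-≡ a b Δ {{>-nonZero 0<Δ}} (+-cancelˡ-≡ x _ _ eq)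

  lines-coincide : ∀ {x x' a b i j} → i < j → x + i * a ≡ x' + i * b → x + j * a ≡ x' + j * b →
                   a ≡ b × x ≡ x'
  lines-coincide {x} {x'} {a} {b} {i} {j} i<j at-i at-j =
    same-slope , +-cancelʳ-≡ (i * a) x x' (trans at-i (cong (λ s → x' + i * s) (sym same-slope)))
    where
    same-slope : a ≡ b
    same-slope = +-*-cancelˡ (x + i * a) (m<n⇒0<n∸m i<j) (begin
      x + i * a + (j ∸ i) * a   ≡⟨ line-step x a (<⇒≤ i<j) ⟨
      x + j * a                 ≡⟨ at-j ⟩
      x' + j * b                ≡⟨ line-step x' b (<⇒≤ i<j) ⟩
      x' + i * b + (j ∸ i) * b  ≡⟨ cong (_+ (j ∸ i) * b) at-i ⟨
      x + i * a + (j ∸ i) * b   ∎)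
      where open ≡-Reasoning

  lift : ∀ {K} → (Fin K → ℕ) → Fin (suc K) → ℕ
  lift y zero    = ‖ y ‖²
  lift y (suc c) = y c

  lift-cong : ∀ {K} {y y' : Fin K → ℕ} → (∀ c → y c ≡ y' c) → ∀ e → lift y e ≡ lift y' e
  lift-cong same zero    = sum-cong-≗ (λ c → cong₂ _*_ (same c) (same c))
  lift-cong same (suc c) = same c

  Increasing : ∀ {t} → (Fin (suc t) → ℕ) → Set
  Increasing level = ∀ j → level (inject₁ j) < level (suc j)

  gap : ∀ {t} → (Fin (suc t) → ℕ) → Fin t → ℕ
  gap level j = level (suc j) ∸ level (inject₁ j)

  -- Cycles of the construction below
  -- are exactly of this shape.
  record LiftedCycle (K : ℕ) {t} (level : Fin (suc t) → ℕ) : Set where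
    field
      position  : Fin (suc t) → Fin (suc K) → ℕ
      direction : Fin t → Fin K → ℕ
      chord     : Fin K → ℕ
      step  : ∀ j e → position (suc j) e ≡ position (inject₁ j) e + gap level j * lift (direction j) e
      close : ∀ e → position (fromℕ t) e ≡ position zero e + (level (fromℕ t) ∸ level zero) * lift chord e

    -- Telescoping the steps and comparing with the chord shows that the chord's
    -- lift is the gap-weighted average of the steps' lifts; by strict convexity
    -- every step then has the chord's direction.
    straight : Increasing level → ∀ j c → direction j c ≡ chord c
    straight increasing =
      paraboloid-rigidity (gap level) direction chord (λ j → m<n⇒0<n∸m (increasing j))
        (λ c → balance (suc c)) (balance zero)
      where
      span : level (fromℕ t) ∸ level zero ≡ sum (gap level)
      span = trans (cong (_∸ level zero) (telescope level (gap level)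
                     (λ j → sym (m+[n∸m]≡n (<⇒≤ (increasing j))))))
                   (m+n∸m≡n (level zero) (sum (gap level)))
      balance : ∀ e → sum (λ j → gap level j * lift (direction j) e) ≡ sum (gap level) * lift chord e
      balance e = +-cancelˡ-≡ (position zero e) _ _ (begin
        position zero e + sum (λ j → gap level j * lift (direction j) e)
          ≡⟨ telescope (λ j → position j e) (λ j → gap level j * lift (direction j) e) (λ j → step j e) ⟨
        position (fromℕ t) e
          ≡⟨ close e ⟩
        position zero e + (level (fromℕ t) ∸ level zero) * lift chord e
          ≡⟨ cong (λ s → position zero e + s * lift chord e) span ⟩
        position zero e + sum (gap level) * lift chord e ∎)
        where open ≡-Reasoning

  open LiftedCycle

  -- Consequently a lifted cycle with at least one step is determined by its
  -- first two positions: they fix the common direction, which fixes every step.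
  lifted-cycle-determined : ∀ {K t} {level : Fin (suc (suc t)) → ℕ} → Increasing level →
    (W W' : LiftedCycle K level) →
    (∀ e → position W zero e ≡ position W' zero e) →
    (∀ e → position W (suc zero) e ≡ position W' (suc zero) e) →
    ∀ j e → position W j e ≡ position W' j e
  lifted-cycle-determined {level = level} increasing W W' same₀ same₁ =
    <-weakInduction (λ j → ∀ e → position W j e ≡ position W' j e) same₀ advance
    where
    first-direction : ∀ c → direction W zero c ≡ direction W' zero c
    first-direction c = +-*-cancelˡ (position W zero (suc c)) (m<n⇒0<n∸m (increasing zero)) (begin
      position W zero (suc c) + gap level zero * direction W zero c   ≡⟨ step W zero (suc c) ⟨
      position W (suc zero) (suc c)                                   ≡⟨ same₁ (suc c) ⟩
      position W' (suc zero) (suc c)                                  ≡⟨ step W' zero (suc c) ⟩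
      position W' zero (suc c) + gap level zero * direction W' zero c ≡⟨ cong (_+ _) (same₀ (suc c)) ⟨
      position W zero (suc c) + gap level zero * direction W' zero c  ∎)
      where open ≡-Reasoning
    same-direction : ∀ j c → direction W j c ≡ direction W' j c
    same-direction j c = begin
      direction W j c     ≡⟨ straight W increasing j c ⟩
      chord W c           ≡⟨ straight W increasing zero c ⟨
      direction W zero c  ≡⟨ first-direction c ⟩
      direction W' zero c ≡⟨ straight W' increasing zero c ⟩
      chord W' c          ≡⟨ straight W' increasing j c ⟨
      direction W' j c    ∎
      where open ≡-Reasoning
    advance : ∀ j → (∀ e → position W (inject₁ j) e ≡ position W' (inject₁ j) e) →
              ∀ e → position W (suc j) e ≡ position W' (suc j) e
    advance j same e = begin
      position W (suc j) e                                          ≡⟨ step W j e ⟩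
      position W (inject₁ j) e + gap level j * lift (direction W j) e
        ≡⟨ cong₂ (λ p q → p + gap level j * q) (same e) (lift-cong (same-direction j) e) ⟩
      position W' (inject₁ j) e + gap level j * lift (direction W' j) e ≡⟨ step W' j e ⟨
      position W' (suc j) e                                         ∎
      where open ≡-Reasoning

  lookup-injective : ∀ {A : Set} {xs : List A} → Unique xs → ∀ {i j} → List.lookup xs i ≡ List.lookup xs j → i ≡ j
  lookup-injective (_ ∷ _)      {zero}  {zero}  _  = refl
  lookup-injective (x∉xs ∷ _)   {zero}  {suc j} eq = ⊥-elim (All.lookup x∉xs (∈-lookup j) eq)
  lookup-injective (x∉xs ∷ _)   {suc i} {zero}  eq = ⊥-elim (All.lookup x∉xs (∈-lookup i) (sym eq))
  lookup-injective (_ ∷ unique) {suc i} {suc j} eq = cong suc (lookup-injective unique eq)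

  unique-length-≤ : ∀ {A : Set} {M} (xs : List A) → Unique xs → (label : A → Fin M) →
    (∀ {x y} → x ∈ xs → y ∈ xs → label x ≡ label y → x ≡ y) → length xs ≤ M
  unique-length-≤ xs unique label injective = Fin.injective⇒≤
    (λ eq → lookup-injective unique (injective (∈-lookup _) (∈-lookup _) eq))

  filter-length-≤ : ∀ {A : Set} {M} (xs : List A) → Unique xs → (P : A → Bool) → (label : A → Fin M) →
    (∀ x y → T (P x) → T (P y) → label x ≡ label y → x ≡ y) → length (filterᵇ P xs) ≤ M
  filter-length-≤ xs unique P label injective =
    unique-length-≤ (filterᵇ P xs) (Unique.filter⁺ (T? ∘ P) unique) label
      (λ x∈ y∈ → injective _ _ (satisfied x∈) (satisfied y∈))
    where
    satisfied : ∀ {x} → x ∈ filterᵇ P xs → T (P x)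
    satisfied x∈ = proj₂ (∈-filter⁻ (T? ∘ P) {xs = xs} x∈)

  allVecs-unique : ∀ n t → Unique (allVecs n t)
  allVecs-unique n zero    = All.[] ∷ []
  allVecs-unique n (suc t) = extensions-unique (allVecs n t) (allVecs-unique n t)
    where
    extensions : Vec (Fin n) t → List (Vec (Fin n) (suc t))
    extensions v = List.map (_∷ v) (allFin n)
    extension-tail : ∀ {w} v → w ∈ extensions v → Vec.tail w ≡ v
    extension-tail v w∈ with ∈-map⁻ (_∷ v) w∈
    ... | _ , _ , refl = refl
    extensions-unique : ∀ vs → Unique vs → Unique (concat (List.map extensions vs))
    extensions-unique []       _              = []
    extensions-unique (v ∷ vs) (v∉vs ∷ unique) =
      Unique.++⁺ (Unique.map⁺ Vec.∷-injectiveˡ (Unique.allFin⁺ n)) (extensions-unique vs unique) disjoint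
      where
      disjoint : ∀ {w} → w ∈ extensions v × w ∈ concat (List.map extensions vs) → ⊥
      disjoint (w∈ , w∈rest) with ∈-concat⁻′ (List.map extensions vs) w∈rest
      ... | _ , w∈ext , ext∈ with ∈-map⁻ extensions ext∈
      ... | v' , v'∈vs , refl = All.lookup v∉vs v'∈vs (trans (sym (extension-tail v w∈)) (extension-tail v' w∈ext))

  remQuot-injective : ∀ {m} n {x y : Fin (m * n)} → remQuot {m} n x ≡ remQuot n y → x ≡ y
  remQuot-injective {m} n {x} {y} eq = begin
    x                                  ≡⟨ combine-remQuot {m} n x ⟨
    uncurry combine (remQuot {m} n x)  ≡⟨ cong (uncurry combine) eq ⟩
    uncurry combine (remQuot {m} n y)  ≡⟨ combine-remQuot {m} n y ⟩
    y                                  ∎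
    where open ≡-Reasoning

  funToFin-cong : ∀ {m n} {f g : Fin m → Fin n} → (∀ i → f i ≡ g i) → funToFin f ≡ funToFin g
  funToFin-cong {zero}  same = refl
  funToFin-cong {suc m} same = cong₂ combine (same zero) (funToFin-cong (same ∘ suc))

  finToFun-injective : ∀ {m n} {x y : Fin (n ^ m)} → (∀ i → finToFun {n} {m} x i ≡ finToFun y i) → x ≡ y
  finToFun-injective {m} {n} {x} {y} same = begin
    x                                 ≡⟨ funToFin-finToFin {m} {n} x ⟨
    funToFin (finToFun {n} {m} x)     ≡⟨ funToFin-cong {m} {n} same ⟩
    funToFin (finToFun {n} {m} y)     ≡⟨ funToFin-finToFin {m} {n} y ⟩
    y                                 ∎
    where open ≡-Reasoning

  -- The grid [a] × [b]ᴷ, encoded as Fin (a * b ^ K).  A grid point is read as a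
  -- point of ℕ^(1+K) whose coordinate 0 is below a and whose others are below b.
  module Grid (a b K : ℕ) where

    Point : Set
    Point = Fin (a * b ^ K)

    side : Fin (suc K) → ℕ
    side zero    = a
    side (suc _) = b

    split : Point → Fin a × Fin (b ^ K)
    split = remQuot {a} (b ^ K)

    coords : Point → Fin (suc K) → ℕ
    coords x zero    = toℕ (proj₁ (split x))
    coords x (suc c) = toℕ (finToFun {b} {K} (proj₂ (split x)) c)

    coords<side : ∀ x e → coords x e < side e
    coords<side x zero    = toℕ<n _
    coords<side x (suc c) = toℕ<n _

    coords-injective : ∀ {x y} → (∀ e → coords x e ≡ coords y e) → x ≡ y
    coords-injective same = remQuot-injective {a} (b ^ K)
      (×-≡,≡→≡ (toℕ-injective (same zero) , finToFun-injective (λ c → toℕ-injective (same (suc c)))))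

    fromCoords : (p : Fin (suc K) → ℕ) → (∀ e → p e < side e) → Point
    fromCoords p p<side = combine (fromℕ< (p<side zero)) (funToFin (λ c → fromℕ< (p<side (suc c))))

    coords-fromCoords : ∀ p p<side e → coords (fromCoords p p<side) e ≡ p e
    coords-fromCoords p p<side zero = begin
      toℕ (proj₁ (split (fromCoords p p<side)))           ≡⟨ cong (toℕ ∘ proj₁) (remQuot-combine {a} {b ^ K} _ _) ⟩
      toℕ (fromℕ< (p<side zero))                          ≡⟨ toℕ-fromℕ< (p<side zero) ⟩
      p zero                                              ∎
      where open ≡-Reasoning
    coords-fromCoords p p<side (suc c) = begin
      toℕ (finToFun {b} {K} (proj₂ (split (fromCoords p p<side))) c)
        ≡⟨ cong (λ r → toℕ (finToFun {b} {K} (proj₂ r) c)) (remQuot-combine {a} {b ^ K} _ _) ⟩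
      toℕ (finToFun {b} {K} (funToFin (λ c → fromℕ< (p<side (suc c)))) c)
        ≡⟨ cong toℕ (finToFun-funToFin _ c) ⟩
      toℕ (fromℕ< (p<side (suc c)))
        ≡⟨ toℕ-fromℕ< (p<side (suc c)) ⟩
      p (suc c) ∎
      where open ≡-Reasoning

  witness : ∀ {A : Set} (a? : Dec A) → does a? ≡ true → A
  witness (yes a) _ = a

  -- A direction y ∈ [d]ᴷ is lifted to ŷ = (‖y‖², y); for every base point x of
  -- the box B = [g·Zb] × [g·d]ᴷ and every direction y, the vertices
  -- (i, x + i·ŷ), i < h, form an h-clique.  Vertex i lies in part i, positions
  -- range over the doubled box [2g·Zb] × [2g·d]ᴷ, and R is the union of these
  -- cliques.
  module Construction (h g K d : ℕ) (h≤g : h ≤ g) where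

    -- Zb bounds ‖y‖² for every direction y ∈ [d]ᴷ.
    Zb : ℕ
    Zb = suc (K * (d * d))

    module Base     = Grid (g * Zb) (g * d) K
    module Position = Grid (g * Zb + g * Zb) (g * d + g * d) K

    M N : ℕ
    M = (g * Zb + g * Zb) * (g * d + g * d) ^ K
    N = h * M

    vertex : Fin h → Position.Point → Fin N
    vertex = combine

    part : Fin N → Fin h
    part u = proj₁ (remQuot M u)

    coord : Fin N → Fin (suc K) → ℕ
    coord u = Position.coords (proj₂ (remQuot {h} M u))

    part-vertex : ∀ i x → part (vertex i x) ≡ i
    part-vertex i x = cong proj₁ (remQuot-combine i x)

    coord-vertex : ∀ i x e → coord (vertex i x) e ≡ Position.coords x e
    coord-vertex i x e = cong (λ r → Position.coords (proj₂ r) e) (remQuot-combine i x)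

    vertex-ext : ∀ {u v} → part u ≡ part v → (∀ e → coord u e ≡ coord v e) → u ≡ v
    vertex-ext same-part same-coord =
      remQuot-injective M (×-≡,≡→≡ (same-part , Position.coords-injective same-coord))

    Direction : Set
    Direction = Fin K → Fin d

    ŷ : Direction → Fin (suc K) → ℕ
    ŷ y = lift (toℕ ∘ y)

    scale : Fin (suc K) → ℕ
    scale zero    = Zb
    scale (suc _) = d

    ŷ<scale : ∀ y e → ŷ y e < scale e
    ŷ<scale y zero    = s≤s (sum-≤ (λ c → *-mono-≤ (<⇒≤ (toℕ<n (y c))) (<⇒≤ (toℕ<n (y c)))))
    ŷ<scale y (suc c) = toℕ<n (y c)

    base-side : ∀ e → Base.side e ≡ g * scale e
    base-side zero    = refl
    base-side (suc _) = refl

    position-side : ∀ e → Position.side e ≡ Base.side e + Base.side e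
    position-side zero    = refl
    position-side (suc _) = refl

    -- i·ŷ_e < g·scale_e, since i < h ≤ g.
    multiple<base : ∀ (i : Fin h) y e → toℕ i * ŷ y e < Base.side e
    multiple<base i y e = subst (toℕ i * ŷ y e <_) (sym (base-side e))
      (≤-<-trans (*-monoʳ-≤ (toℕ i) (<⇒≤ (ŷ<scale y e)))
                 (*-monoˡ-< (scale e) {{>-nonZero (≤-<-trans z≤n (ŷ<scale y e))}}
                            (<-≤-trans (toℕ<n i) h≤g)))

    -- At coordinate e, u and v lie on a line of slope s through a point of the
    -- base box: v = u + (j − i)·s and u − i·s lies in the box, where i and j are
    -- the parts of u and v.
    OnLine : Fin N → Fin N → ℕ → Fin (suc K) → Set
    OnLine u v s e = (coord v e ≡ coord u e + (toℕ (part v) ∸ toℕ (part u)) * s)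
                   × (toℕ (part u) * s ≤ coord u e)
                   × (coord u e ∸ toℕ (part u) * s < Base.side e)

    Aligned : Fin N → Fin N → Direction → Set
    Aligned u v y = ∀ e → OnLine u v (ŷ y e) e

    Joined : Fin N → Fin N → Set
    Joined u v = part u Fin.< part v × Σ Direction (Aligned u v)

    joined? : ∀ u v → Dec (Joined u v)
    joined? u v = (part u Fin.<? part v) ×-dec aligned?
      where
      on-line? : ∀ s e → Dec (OnLine u v s e)
      on-line? s e = (coord v e ≟ _) ×-dec (_ ≤? _) ×-dec (_ <? _)
      aligned? : Dec (Σ Direction (Aligned u v))
      aligned? with Fin.any? {d ^ K} (λ k → Fin.all? (λ e → on-line? (ŷ (finToFun k) e) e))
      ... | yes (k , aligned) = yes (finToFun k , aligned)
      ... | no none = no λ (y , aligned) → none (funToFin y , λ e →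
              subst (λ s → OnLine u v s e)
                    (lift-cong (λ c → cong toℕ (sym (finToFun-funToFin y c))) e) (aligned e))

    adjacent : Fin N → Fin N → Bool
    adjacent u v = does (joined? u v ⊎-dec joined? v u)

    unjoined-within-part : ∀ {u v} → part u ≡ part v → ¬ (Joined u v ⊎ Joined v u)
    unjoined-within-part same (inj₁ (u<v , _)) = Fin.<-irrefl same u<v
    unjoined-within-part same (inj₂ (v<u , _)) = Fin.<-irrefl (sym same) v<u

    R : Graph N
    R = record
      { adj    = adjacent
      ; sym    = λ u v → ∨-comm (does (joined? u v)) (does (joined? v u))
      ; irrefl = λ v → dec-false (joined? v v ⊎-dec joined? v v) (unjoined-within-part refl)
      }

    independent : ∀ u v → part u ≡ part v → adjacent u v ≡ false
    independent u v same = dec-false (joined? u v ⊎-dec joined? v u) (unjoined-within-part same)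

    joined⇒adjacent : ∀ {u v} → Joined u v ⊎ Joined v u → adjacent u v ≡ true
    joined⇒adjacent {u} {v} = dec-true (joined? u v ⊎-dec joined? v u)

    adjacent⇒joined : ∀ {u v} → adjacent u v ≡ true → Joined u v ⊎ Joined v u
    adjacent⇒joined {u} {v} = witness (joined? u v ⊎-dec joined? v u)

    adjacent-ordered⇒joined : ∀ {u v} → part u Fin.< part v → adjacent u v ≡ true → Joined u v
    adjacent-ordered⇒joined u<v adj =
      [ id , (λ (v<u , _) → ⊥-elim (Fin.<-asym u<v v<u)) ]′ (adjacent⇒joined adj)

    m : ℕ
    m = g * Zb * (g * d) ^ K * d ^ K

    clique-index : Base.Point → Direction → Fin m
    clique-index x y = combine x (funToFin y)

    base : Fin m → Base.Point
    base k = proj₁ (remQuot (d ^ K) k)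

    slope : Fin m → Direction
    slope k = finToFun (proj₂ (remQuot {g * Zb * (g * d) ^ K} (d ^ K) k))

    base-index : ∀ x y → base (clique-index x y) ≡ x
    base-index x y = cong proj₁ (remQuot-combine x (funToFin y))

    slope-index : ∀ x y c → slope (clique-index x y) c ≡ y c
    slope-index x y c = trans (cong (λ r → finToFun (proj₂ r) c) (remQuot-combine x (funToFin y)))
                              (finToFun-funToFin y c)

    clique-ext : ∀ {k l} → base k ≡ base l → (∀ c → slope k c ≡ slope l c) → k ≡ l
    clique-ext same-base same-slope = remQuot-injective (d ^ K) (×-≡,≡→≡ (same-base , finToFun-injective same-slope))

    member : Fin m → Fin h → Fin (suc K) → ℕ
    member k i e = Base.coords (base k) e + toℕ i * ŷ (slope k) e

    member<side : ∀ k i e → member k i e < Position.side e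
    member<side k i e = subst (member k i e <_) (sym (position-side e))
      (+-mono-< (Base.coords<side (base k) e) (multiple<base i (slope k) e))

    clique : Fin m → Fin h → Fin N
    clique k i = vertex i (Position.fromCoords (member k i) (member<side k i))

    part-clique : ∀ k i → part (clique k i) ≡ i
    part-clique k i = part-vertex i _

    coord-clique : ∀ k i e → coord (clique k i) e ≡ member k i e
    coord-clique k i e = trans (coord-vertex i _ e) (Position.coords-fromCoords (member k i) (member<side k i) e)

    on-line-through : ∀ {u v} x s e → toℕ (part u) ≤ toℕ (part v) → x < Base.side e →
      coord u e ≡ x + toℕ (part u) * s → coord v e ≡ x + toℕ (part v) * s → OnLine u v s e
    on-line-through {u} {v} x s e i≤j x<side at-u at-v =
        trans at-v (trans (line-step x s i≤j) (cong (_+ _) (sym at-u)))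
      , subst (toℕ (part u) * s ≤_) (sym at-u) (m≤n+m _ x)
      , subst (λ c → c ∸ toℕ (part u) * s < Base.side e) (sym at-u)
              (subst (_< Base.side e) (sym (m+n∸n≡m x (toℕ (part u) * s))) x<side)

    clique-joined : ∀ k i j → i Fin.< j → Joined (clique k i) (clique k j)
    clique-joined k i j i<j = parts-ordered , slope k , λ e →
      on-line-through (Base.coords (base k) e) (ŷ (slope k) e) e (<⇒≤ parts-ordered)
        (Base.coords<side (base k) e) (at i e) (at j e)
      where
      parts-ordered : part (clique k i) Fin.< part (clique k j)
      parts-ordered = subst₂ Fin._<_ (sym (part-clique k i)) (sym (part-clique k j)) i<j
      at : ∀ p e → coord (clique k p) e ≡ Base.coords (base k) e + toℕ (part (clique k p)) * ŷ (slope k) e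
      at p e = trans (coord-clique k p e) (cong (λ q → Base.coords (base k) e + toℕ q * ŷ (slope k) e) (sym (part-clique k p)))

    clique-is-clique : ∀ k → IsClique R h (clique k)
    clique-is-clique k = distinct , λ i j i≢j → joined⇒adjacent (ordered i j i≢j)
      where
      distinct : ∀ i j → i ≢ j → clique k i ≢ clique k j
      distinct i j i≢j same = i≢j (trans (sym (part-clique k i)) (trans (cong part same) (part-clique k j)))
      ordered : ∀ i j → i ≢ j → Joined (clique k i) (clique k j) ⊎ Joined (clique k j) (clique k i)
      ordered i j i≢j = by-order (Fin.<-cmp i j)
        where
        by-order : Tri (i Fin.< j) (i ≡ j) (j Fin.< i) → Joined (clique k i) (clique k j) ⊎ Joined (clique k j) (clique k i)
        by-order (tri< i<j _ _) = inj₁ (clique-joined k i j i<j)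
        by-order (tri≈ _ i≡j _) = ⊥-elim (i≢j i≡j)
        by-order (tri> _ _ j<i) = inj₂ (clique-joined k j i j<i)

    -- Joined vertices u, v lie on the clique through their base point u − i·ŷ.
    joined-in-clique : ∀ {u v} → Joined u v → ∃[ k ] (clique k (part u) ≡ u × clique k (part v) ≡ v)
    joined-in-clique {u} {v} (u<v , y , aligned) =
      k , vertex-ext (part-clique k (part u)) at-u , vertex-ext (part-clique k (part v)) at-v
      where
      i = toℕ (part u)
      x₀ : Fin (suc K) → ℕ
      x₀ e = coord u e ∸ i * ŷ y e
      x : Base.Point
      x = Base.fromCoords x₀ (λ e → proj₂ (proj₂ (aligned e)))
      k = clique-index x y
      member-k : ∀ (p : Fin h) e → member k p e ≡ x₀ e + toℕ p * ŷ y e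
      member-k p e = cong₂ (λ a s → a + toℕ p * s)
        (trans (cong (λ x → Base.coords x e) (base-index x y)) (Base.coords-fromCoords x₀ (λ e → proj₂ (proj₂ (aligned e))) e))
        (lift-cong (λ c → cong toℕ (slope-index x y c)) e)
      at-u : ∀ e → coord (clique k (part u)) e ≡ coord u e
      at-u e = trans (coord-clique k (part u) e) (trans (member-k (part u) e) (m∸n+n≡m (proj₁ (proj₂ (aligned e)))))
      at-v : ∀ e → coord (clique k (part v)) e ≡ coord v e
      at-v e = begin
        coord (clique k (part v)) e                 ≡⟨ coord-clique k (part v) e ⟩
        member k (part v) e                         ≡⟨ member-k (part v) e ⟩
        x₀ e + toℕ (part v) * ŷ y e                 ≡⟨ line-step (x₀ e) (ŷ y e) (<⇒≤ u<v) ⟩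
        x₀ e + i * ŷ y e + (toℕ (part v) ∸ i) * ŷ y e
          ≡⟨ cong (_+ (toℕ (part v) ∸ i) * ŷ y e) (m∸n+n≡m (proj₁ (proj₂ (aligned e)))) ⟩
        coord u e + (toℕ (part v) ∸ i) * ŷ y e      ≡⟨ proj₁ (aligned e) ⟨
        coord v e                                   ∎
        where open ≡-Reasoning

    edge-in-clique : ∀ u v → adjacent u v ≡ true → ∃[ k ] ∃[ i ] ∃[ j ] (clique k i ≡ u × clique k j ≡ v)
    edge-in-clique u v adj = [ forward , backward ]′ (adjacent⇒joined adj)
      where
      forward : Joined u v → ∃[ k ] ∃[ i ] ∃[ j ] (clique k i ≡ u × clique k j ≡ v)
      forward joined = let (k , at-u , at-v) = joined-in-clique joined in k , part u , part v , at-u , at-v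
      backward : Joined v u → ∃[ k ] ∃[ i ] ∃[ j ] (clique k i ≡ u × clique k j ≡ v)
      backward joined = let (k , at-v , at-u) = joined-in-clique joined in k , part u , part v , at-u , at-v

    -- (3b) Distinct cliques share no edge: two of their common vertices in distinct
    -- parts pin down the line, i.e. both the base point and the direction.
    cliques-edge-disjoint : ∀ k l → k ≢ l → ∀ i j i' j' → i ≢ j →
                            ¬ (clique k i ≡ clique l i' × clique k j ≡ clique l j')
    cliques-edge-disjoint k l k≢l i j i' j' i≢j (same-i , same-j) =
      k≢l (clique-ext (Base.coords-injective (λ e → proj₂ (coincide e)))
                      (λ c → toℕ-injective (proj₁ (coincide (suc c)))))
      where
      shared : ∀ {p p'} → clique k p ≡ clique l p' → ∀ e → member k p e ≡ member l p e
      shared {p} {p'} same e = begin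
        member k p e          ≡⟨ coord-clique k p e ⟨
        coord (clique k p) e  ≡⟨ cong (λ w → coord w e) same ⟩
        coord (clique l p') e ≡⟨ coord-clique l p' e ⟩
        member l p' e         ≡⟨ cong (λ q → member l q e) p'≡p ⟩
        member l p e          ∎
        where
        open ≡-Reasoning
        p'≡p : p' ≡ p
        p'≡p = trans (sym (part-clique l p')) (trans (cong part (sym same)) (part-clique k p))
      coincide : ∀ e → ŷ (slope k) e ≡ ŷ (slope l) e × Base.coords (base k) e ≡ Base.coords (base l) e
      coincide e with Fin.<-cmp i j
      ... | tri< i<j _ _ = lines-coincide i<j (shared same-i e) (shared same-j e)
      ... | tri≈ _ i≡j _ = ⊥-elim (i≢j i≡j)
      ... | tri> _ _ j<i = lines-coincide j<i (shared same-j e) (shared same-i e)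

    decomposition : IsEdgeDisjointCliqueDecomposition R h m clique
    decomposition = clique-is-clique , edge-in-clique , cliques-edge-disjoint

    in-parts : ∀ {t} (s : Fin t → Fin h) (v : Vec (Fin N) t) → T (inPartsᵇ part s v) →
               ∀ j → part (lookup v j) ≡ s j
    in-parts s (x ∷ xs) holds j with part x Fin.≟ s zero
    in-parts s (x ∷ xs) holds zero    | yes in-part = in-part
    in-parts s (x ∷ xs) holds (suc j) | yes _       = in-parts (s ∘ suc) xs holds j

    closes : ∀ {t} first x (xs : Vec (Fin N) t) → T (closesAt R first (x ∷ xs)) →
             (∀ j → adjacent (lookup (x ∷ xs) (inject₁ j)) (lookup (x ∷ xs) (suc j)) ≡ true)
             × adjacent (lookup (x ∷ xs) (fromℕ t)) first ≡ true
    closes first x []       closed = (λ ()) , Equivalence.to T-≡ closed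
    closes first x (y ∷ ys) closed =
      let (x~y , rest) = Equivalence.to T-∧ closed
          (steps , last~first) = closes first y ys rest
      in (λ { zero → Equivalence.to T-≡ x~y ; (suc j) → steps j }) , last~first

    module CyclesThrough {t} (s : Fin (suc (suc t)) → Fin h) (increasing : StrictlyIncreasing s) where

      level : Fin (suc (suc t)) → ℕ
      level = toℕ ∘ s

      level-increasing : Increasing level
      level-increasing j = increasing (inject₁ j) (suc j) (Fin.≤̄⇒inject₁< Fin.≤-refl)

      cycle-parts : ∀ v → T (isCycleᵇ R part s v) → ∀ j → part (lookup v j) ≡ s j
      cycle-parts (x ∷ xs) is-cycle =
        in-parts s (x ∷ xs) (proj₁ (Equivalence.to (T-∧ {inPartsᵇ part s (x ∷ xs)} {closesAt R x (x ∷ xs)}) is-cycle))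

      cycle-closes : ∀ x xs → T (isCycleᵇ R part s (x ∷ xs)) → T (closesAt R x (x ∷ xs))
      cycle-closes x xs is-cycle =
        proj₂ (Equivalence.to (T-∧ {inPartsᵇ part s (x ∷ xs)} {closesAt R x (x ∷ xs)}) is-cycle)

      -- Such a cycle is a lifted cycle over the levels s: each edge, read in the
      -- direction of increasing parts, is a multiple of a lifted direction.
      cycle-lift : (v : Vec (Fin N) (suc (suc t))) → T (isCycleᵇ R part s v) → LiftedCycle K level
      cycle-lift (x ∷ xs) is-cycle = record
        { position  = λ j → coord (lookup v j)
        ; direction = λ j → toℕ ∘ proj₁ (proj₂ (step-joined j))
        ; chord     = toℕ ∘ proj₁ (proj₂ chord-joined)
        ; step      = λ j → along (step-joined j)
        ; close     = along chord-joined
        }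
        where
        v = x ∷ xs
        parts : ∀ j → part (lookup v j) ≡ s j
        parts = cycle-parts v is-cycle
        edges : (∀ j → adjacent (lookup v (inject₁ j)) (lookup v (suc j)) ≡ true)
                × adjacent (lookup v (fromℕ (suc t))) x ≡ true
        edges = closes x x xs (cycle-closes x xs is-cycle)
        ordered : ∀ i j → i Fin.< j → part (lookup v i) Fin.< part (lookup v j)
        ordered i j i<j = subst₂ Fin._<_ (sym (parts i)) (sym (parts j)) (increasing i j i<j)
        step-joined : ∀ j → Joined (lookup v (inject₁ j)) (lookup v (suc j))
        step-joined j = adjacent-ordered⇒joined {lookup v (inject₁ j)} {lookup v (suc j)}
                          (ordered (inject₁ j) (suc j) (Fin.≤̄⇒inject₁< Fin.≤-refl)) (proj₁ edges j)
        chord-joined : Joined (lookup v zero) (lookup v (fromℕ (suc t)))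
        chord-joined = adjacent-ordered⇒joined {x} {lookup v (fromℕ (suc t))} (ordered zero (fromℕ (suc t)) (s≤s z≤n))
                         (trans (Graph.sym R x (lookup v (fromℕ (suc t)))) (proj₂ edges))
        along : ∀ {i j} (joined : Joined (lookup v i) (lookup v j)) e →
                coord (lookup v j) e ≡ coord (lookup v i) e + (level j ∸ level i) * lift (toℕ ∘ proj₁ (proj₂ joined)) e
        along {i} {j} (_ , y , aligned) e = trans (proj₁ (aligned e))
          (cong (λ δ → coord (lookup v i) e + δ * ŷ y e) (cong₂ _∸_ (cong toℕ (parts j)) (cong toℕ (parts i))))

      -- (4) A cycle through s is determined by its first edge, so there are at most N² of them.
      cycle-count-≤ : cycleCount R part (suc (suc t)) s ≤ N * N
      cycle-count-≤ = filter-length-≤ (allVecs N (suc (suc t))) (allVecs-unique N (suc (suc t)))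
                        (isCycleᵇ R part s) first-edge determined
        where
        first-edge : Vec (Fin N) (suc (suc t)) → Fin (N * N)
        first-edge v = combine (lookup v zero) (lookup v (suc zero))
        determined : ∀ v w → T (isCycleᵇ R part s v) → T (isCycleᵇ R part s w) → first-edge v ≡ first-edge w → v ≡ w
        determined v@(_ ∷ _) w@(_ ∷ _) v-cycle w-cycle same-edge = begin
          v                   ≡⟨ tabulate∘lookup v ⟨
          tabulate (lookup v) ≡⟨ tabulate-cong same-entry ⟩
          tabulate (lookup w) ≡⟨ tabulate∘lookup w ⟩
          w                   ∎
          where
          open ≡-Reasoning
          same-start = combine-injective (lookup v zero) (lookup v (suc zero)) (lookup w zero) (lookup w (suc zero)) same-edge
          same-position = lifted-cycle-determined level-increasing (cycle-lift v v-cycle) (cycle-lift w w-cycle)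
            (λ e → cong (λ u → coord u e) (proj₁ same-start)) (λ e → cong (λ u → coord u e) (proj₂ same-start))
          same-entry : ∀ j → lookup v j ≡ lookup w j
          same-entry j = vertex-ext (trans (cycle-parts v v-cycle j) (sym (cycle-parts w w-cycle j))) (same-position j)

    cycle-counts : (t : ℕ) → 3 ≤ t → t ≤ h → (s : Fin t → Fin h) → StrictlyIncreasing s →
                   cycleCount R part t s ≤ N * N
    cycle-counts (suc (suc t)) (s≤s (s≤s _)) _ s increasing = CyclesThrough.cycle-count-≤ s increasing

    overhead : ℕ
    overhead = h * h * (4 * g * Zb) * (4 * g) ^ K

    size-identity : N * N ≡ m * overhead
    size-identity = begin
      N * N                                              ≡⟨ regroup h P (Q ^ K) ⟩
      h * h * (P * P) * (Q ^ K * Q ^ K)                  ≡⟨ cong (h * h * (P * P) *_) (^-distribʳ-* Q Q K) ⟨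
      h * h * (P * P) * (Q * Q) ^ K                      ≡⟨ cong (λ z → h * h * (P * P) * z ^ K) (square-side g d) ⟩
      h * h * (P * P) * (g * d * d * (4 * g)) ^ K
        ≡⟨ cong (h * h * (P * P) *_) (trans (^-distribʳ-* (g * d * d) (4 * g) K)
                                            (cong (_* (4 * g) ^ K) (^-distribʳ-* (g * d) d K))) ⟩
      h * h * (P * P) * ((g * d) ^ K * d ^ K * (4 * g) ^ K) ≡⟨ split-off h g Zb ((g * d) ^ K) (d ^ K) ((4 * g) ^ K) ⟩
      m * overhead                                       ∎
      where
      open ≡-Reasoning
      P = g * Zb + g * Zb
      Q = g * d + g * d
      regroup : ∀ h p q → h * (p * q) * (h * (p * q)) ≡ h * h * (p * p) * (q * q)
      regroup = solve-∀
      square-side : ∀ g d → (g * d + g * d) * (g * d + g * d) ≡ g * d * d * (4 * g)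
      square-side = solve-∀
      split-off : ∀ h g Z x y z → h * h * ((g * Z + g * Z) * (g * Z + g * Z)) * (x * y * z) ≡
                                   g * Z * x * y * (h * h * (4 * g * Z) * z)
      split-off = solve-∀

    vertices-≥ : 0 < h → 0 < g → d ^ K ≤ N
    vertices-≥ 0<h 0<g = begin
      d ^ K                                  ≤⟨ ^-monoˡ-≤ K (m≤n+m d (g * d)) ⟩
      (g * d + d) ^ K                        ≤⟨ ^-monoˡ-≤ K (+-monoʳ-≤ (g * d) (m≤n*m d g {{>-nonZero 0<g}})) ⟩
      (g * d + g * d) ^ K                    ≤⟨ m≤n*m _ (g * Zb + g * Zb) {{>-nonZero (<-≤-trans 0<g (≤-trans (m≤m*n g Zb) (m≤m+n _ _)))}} ⟩
      M                                      ≤⟨ m≤n*m M h {{>-nonZero 0<h}} ⟩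
      N                                      ∎
      where open ≤-Reasoning

  GraphAtScale : (h c L : ℕ) → Set
  GraphAtScale h c L = ∃[ N ] Σ (Graph N) λ R → Σ (Fin N → Fin h) λ part →
    (∀ u v → part u ≡ part v → adj R u v ≡ false) ×
    (∃[ m ] Σ (Fin m → Fin h → Fin N) λ K → IsEdgeDisjointCliqueDecomposition R h m K × N * N ≤ 2 ^ L * m) ×
    ((t : ℕ) → 3 ≤ t → t ≤ h → (s : Fin t → Fin h) → StrictlyIncreasing s → cycleCount R part t s ≤ N * N) ×
    (∃[ E ] (2 ^ E ≤ N × suc L * suc L ≤ c * E))

  -- The threshold scale and the constant c = 1/β of the theorem.
  threshold constant : ℕ → ℕ
  threshold h = 20 * h + 32
  constant  h = 64 * (3 + h)

  -- The parameters at scale L ≥ threshold h: with A = 3 + h, dimension K = ⌊L / 4A⌋,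
  -- side d = 2ᴰ for D = A·K and g = 2ʰ.  Then the overhead N²/m is at most 2ᴸ
  -- while N ≥ 2^{DK} ≈ 2^{L²/16A}.
  module Scale (h : ℕ) (1≤h : 1 ≤ h) (L : ℕ) (L≥ : threshold h ≤ L) where

    A K D : ℕ
    A = 3 + h
    K = L / (4 * A)
    D = A * K

    open Construction h (2 ^ h) K (2 ^ D) (<⇒≤ (n<2^n h))

    K·4A≤L : K * (4 * A) ≤ L
    K·4A≤L = m/n*n≤m L (4 * A)

    L<[K+1]·4A : L < suc K * (4 * A)
    L<[K+1]·4A = subst (_< suc K * (4 * A)) (sym (m≡m%n+[m/n]*n L (4 * A))) (+-monoˡ-< (K * (4 * A)) (m%n<n L (4 * A)))

    Zb≤ : Zb ≤ 2 ^ (K + (D + D))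
    Zb≤ = begin
      suc (K * (2 ^ D * 2 ^ D))          ≤⟨ +-monoˡ-≤ (K * (2 ^ D * 2 ^ D)) (m^n>0 2 (D + D)) ⟩
      2 ^ (D + D) + K * (2 ^ D * 2 ^ D)  ≡⟨ cong (_+ K * (2 ^ D * 2 ^ D)) (^-distribˡ-+-* 2 D D) ⟩
      suc K * (2 ^ D * 2 ^ D)            ≤⟨ *-monoˡ-≤ (2 ^ D * 2 ^ D) (n<2^n K) ⟩
      2 ^ K * (2 ^ D * 2 ^ D)            ≡⟨ cong (2 ^ K *_) (^-distribˡ-+-* 2 D D) ⟨
      2 ^ K * 2 ^ (D + D)                ≡⟨ ^-distribˡ-+-* 2 K (D + D) ⟨
      2 ^ (K + (D + D))                  ∎
      where open ≤-Reasoning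

    overhead≤ : overhead ≤ 2 ^ (3 * h + 2 + 3 * D)
    overhead≤ = begin
      h * h * (4 * 2 ^ h * Zb) * (4 * 2 ^ h) ^ K
        ≤⟨ *-monoˡ-≤ _ (*-mono-≤ (*-mono-≤ h≤2ʰ h≤2ʰ) (*-monoʳ-≤ (4 * 2 ^ h) Zb≤)) ⟩
      2 ^ h * 2 ^ h * (4 * 2 ^ h * 2 ^ (K + (D + D))) * (4 * 2 ^ h) ^ K
        ≡⟨ cong (λ f → 2 ^ h * 2 ^ h * (f * 2 ^ (K + (D + D))) * f ^ K) (^-distribˡ-+-* 2 2 h) ⟨
      2 ^ h * 2 ^ h * (2 ^ (2 + h) * 2 ^ (K + (D + D))) * (2 ^ (2 + h)) ^ K
        ≡⟨ cong (2 ^ h * 2 ^ h * (2 ^ (2 + h) * 2 ^ (K + (D + D))) *_) (^-*-assoc 2 (2 + h) K) ⟩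
      2 ^ h * 2 ^ h * (2 ^ (2 + h) * 2 ^ (K + (D + D))) * 2 ^ ((2 + h) * K)
        ≡⟨ cong₂ (λ a b → a * b * 2 ^ ((2 + h) * K)) (^-distribˡ-+-* 2 h h) (^-distribˡ-+-* 2 (2 + h) (K + (D + D))) ⟨
      2 ^ (h + h) * 2 ^ (2 + h + (K + (D + D))) * 2 ^ ((2 + h) * K)
        ≡⟨ cong (_* 2 ^ ((2 + h) * K)) (^-distribˡ-+-* 2 (h + h) (2 + h + (K + (D + D)))) ⟨
      2 ^ (h + h + (2 + h + (K + (D + D)))) * 2 ^ ((2 + h) * K)
        ≡⟨ ^-distribˡ-+-* 2 (h + h + (2 + h + (K + (D + D)))) ((2 + h) * K) ⟨
      2 ^ (h + h + (2 + h + (K + (D + D))) + (2 + h) * K)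
        ≡⟨ cong (2 ^_) (collect h K) ⟩
      2 ^ (3 * h + 2 + 3 * D) ∎
      where
      open ≤-Reasoning
      h≤2ʰ = <⇒≤ (n<2^n h)
      collect : ∀ h K → h + h + (2 + h + (K + ((3 + h) * K + (3 + h) * K))) + (2 + h) * K ≡ 3 * h + 2 + 3 * ((3 + h) * K)
      collect = solve-∀

    exponent≤L : 3 * h + 2 + 3 * D ≤ L
    exponent≤L = *-cancelˡ-≤ 4 (begin
      4 * (3 * h + 2 + 3 * D)        ≡⟨ expand h K ⟩
      12 * h + 8 + 3 * (K * (4 * A)) ≤⟨ +-monoʳ-≤ (12 * h + 8) (*-monoʳ-≤ 3 K·4A≤L) ⟩
      12 * h + 8 + 3 * L             ≤⟨ +-monoˡ-≤ (3 * L) (≤-trans (+-mono-≤ (*-monoˡ-≤ h (12≤20)) (8≤32)) L≥) ⟩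
      L + 3 * L                      ≡⟨⟩
      4 * L                          ∎)
      where
      open ≤-Reasoning
      12≤20 : 12 ≤ 20
      12≤20 = s≤s (s≤s (s≤s (s≤s (s≤s (s≤s (s≤s (s≤s (s≤s (s≤s (s≤s (s≤s z≤n)))))))))))
      8≤32 : 8 ≤ 32
      8≤32 = s≤s (s≤s (s≤s (s≤s (s≤s (s≤s (s≤s (s≤s z≤n)))))))
      expand : ∀ h K → 4 * (3 * h + 2 + 3 * ((3 + h) * K)) ≡ 12 * h + 8 + 3 * (K * (4 * (3 + h)))
      expand = solve-∀

    N²≤ : N * N ≤ 2 ^ L * m
    N²≤ = begin
      N * N         ≡⟨ size-identity ⟩
      m * overhead  ≤⟨ *-monoʳ-≤ m (≤-trans overhead≤ (^-monoʳ-≤ 2 exponent≤L)) ⟩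
      m * 2 ^ L     ≡⟨ *-comm m (2 ^ L) ⟩
      2 ^ L * m     ∎
      where open ≤-Reasoning

    2^DK≤N : 2 ^ (D * K) ≤ N
    2^DK≤N = subst (_≤ N) (^-*-assoc 2 D K) (vertices-≥ 1≤h (m^n>0 2 h))

    L+1≤8AK : suc L ≤ 8 * A * K
    L+1≤8AK = +-cancelʳ-≤ (suc L) (suc L) (8 * A * K) (begin
      suc L + suc L                 ≡⟨ cong (suc L +_) (+-identityʳ (suc L)) ⟨
      2 * suc L                     ≤⟨ *-monoʳ-≤ 2 L<[K+1]·4A ⟩
      2 * (suc K * (4 * A))         ≡⟨ expand K h ⟩
      8 * A * K + (8 * h + 24)      ≤⟨ +-monoʳ-≤ (8 * A * K) (≤-trans (+-monoˡ-≤ 24 (*-monoˡ-≤ h 8≤20)) (≤-trans (+-monoʳ-≤ (20 * h) 24≤32) (m≤n⇒m≤1+n L≥))) ⟩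
      8 * A * K + suc L             ∎)
      where
      open ≤-Reasoning
      8≤20 : 8 ≤ 20
      8≤20 = s≤s (s≤s (s≤s (s≤s (s≤s (s≤s (s≤s (s≤s z≤n)))))))
      24≤32 : 24 ≤ 32
      24≤32 = m≤m+n 24 8
      expand : ∀ K h → 2 * (suc K * (4 * (3 + h))) ≡ 8 * (3 + h) * K + (8 * h + 24)
      expand = solve-∀

    [L+1]²≤ : suc L * suc L ≤ 64 * A * (D * K)
    [L+1]²≤ = ≤-trans (*-mono-≤ L+1≤8AK L+1≤8AK) (≤-reflexive (regroup A K))
      where
      regroup : ∀ A K → 8 * A * K * (8 * A * K) ≡ 64 * A * (A * K * K)
      regroup = solve-∀

    graph-at-scale : GraphAtScale h (constant h) L
    graph-at-scale = N , R , part , independent , (m , clique , decomposition , N²≤) , cycle-counts ,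
                     (D * K , 2^DK≤N , [L+1]²≤)

  ℕ→ℚ-toℚᵘ : ∀ a → toℚᵘ (ℕ→ℚ a) ≡ mkℚᵘ (ℤ.+ a) 0
  ℕ→ℚ-toℚᵘ a = cong toℚᵘ (normalize-coprime (Coprime.sym (1-coprimeTo a)))

  ℕ→ℚ-* : ∀ a b → ℕ→ℚ (a * b) ≡ ℕ→ℚ a ℚ.* ℕ→ℚ b
  ℕ→ℚ-* a b = toℚᵘ-injective (ℚᵘ.≃-trans product (ℚᵘ.≃-sym (toℚᵘ-homo-* (ℕ→ℚ a) (ℕ→ℚ b))))
    where
    product : toℚᵘ (ℕ→ℚ (a * b)) ℚᵘ.≃ toℚᵘ (ℕ→ℚ a) ℚᵘ.* toℚᵘ (ℕ→ℚ b)
    product rewrite ℕ→ℚ-toℚᵘ (a * b) | ℕ→ℚ-toℚᵘ a | ℕ→ℚ-toℚᵘ b = ℚᵘ.*≡* (cong (ℤ._* ℤ.+ 1) (ℤ.pos-* a b))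

  ℕ→ℚ-mono : ∀ {a b} → a ≤ b → ℕ→ℚ a ℚ.≤ ℕ→ℚ b
  ℕ→ℚ-mono {a} {b} a≤b = toℚᵘ-cancel-≤ (subst₂ ℚᵘ._≤_ (sym (ℕ→ℚ-toℚᵘ a)) (sym (ℕ→ℚ-toℚᵘ b))
    (ℚᵘ.*≤* (subst₂ ℤ._≤_ (sym (ℤ.*-identityʳ (ℤ.+ a))) (sym (ℤ.*-identityʳ (ℤ.+ b))) (ℤ.+≤+ a≤b))))

  ℕ→ℚ-nonNeg : ∀ a → 0ℚ ℚ.≤ ℕ→ℚ a
  ℕ→ℚ-nonNeg a = ℕ→ℚ-mono {0} {a} z≤n

  ℕ→ℚ-^ : ∀ a n → ℕ→ℚ (a ^ n) ≡ ℕ→ℚ a ^ℚ n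
  ℕ→ℚ-^ a zero    = refl
  ℕ→ℚ-^ a (suc n) = trans (ℕ→ℚ-* a (a ^ n)) (cong (ℕ→ℚ a ℚ.*_) (ℕ→ℚ-^ a n))

  ^ℚ-distrib-* : ∀ x y n → (x ℚ.* y) ^ℚ n ≡ (x ^ℚ n) ℚ.* (y ^ℚ n)
  ^ℚ-distrib-* x y zero    = refl
  ^ℚ-distrib-* x y (suc n) = trans (cong (x ℚ.* y ℚ.*_) (^ℚ-distrib-* x y n)) (interchange x y (x ^ℚ n) (y ^ℚ n))

  ^ℚ-nonNeg : ∀ x n → 0ℚ ℚ.≤ x → 0ℚ ℚ.≤ x ^ℚ n
  ^ℚ-nonNeg x zero    _   = ℚ.nonNegative⁻¹ 1ℚ
  ^ℚ-nonNeg x (suc n) 0≤x = ℚ.≤-trans (ℚ.≤-reflexive (sym (ℚ.*-zeroˡ (x ^ℚ n))))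
    (ℚ.*-monoʳ-≤-nonNeg (x ^ℚ n) {{ℚ.nonNegative (^ℚ-nonNeg x n 0≤x)}} 0≤x)

  1≤* : ∀ x y → 1ℚ ℚ.≤ x → 1ℚ ℚ.≤ y → 1ℚ ℚ.≤ x ℚ.* y
  1≤* x y 1≤x 1≤y = ℚ.≤-trans 1≤y (ℚ.≤-trans (ℚ.≤-reflexive (sym (ℚ.*-identityˡ y)))
    (ℚ.*-monoʳ-≤-nonNeg y {{ℚ.nonNegative (ℚ.≤-trans (ℚ.nonNegative⁻¹ 1ℚ) 1≤y)}} 1≤x))

  1≤^ℚ : ∀ x n → 1ℚ ℚ.≤ x → 1ℚ ℚ.≤ x ^ℚ n
  1≤^ℚ x zero    _   = ℚ.≤-refl
  1≤^ℚ x (suc n) 1≤x = 1≤* x (x ^ℚ n) 1≤x (1≤^ℚ x n 1≤x)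

  ℚ-*-monoʳ-≤ : ∀ {p q} r → 0ℚ ℚ.≤ r → p ℚ.≤ q → p ℚ.* r ℚ.≤ q ℚ.* r
  ℚ-*-monoʳ-≤ r 0≤r = ℚ.*-monoʳ-≤-nonNeg r {{ℚ.nonNegative 0≤r}}

  ℚ-*-monoˡ-≤ : ∀ {p q} r → 0ℚ ℚ.≤ r → p ℚ.≤ q → r ℚ.* p ℚ.≤ r ℚ.* q
  ℚ-*-monoˡ-≤ r 0≤r = ℚ.*-monoˡ-≤-nonNeg r {{ℚ.nonNegative 0≤r}}

  -- For δ = n/(e+1), comparing a·δ with 1 is comparing a·n with e + 1.
  module Fraction (n e : ℕ) .(coprime : Coprime n (suc e)) where

    δ : ℚ
    δ = mkℚ (ℤ.+ n) e coprime

    scaled≤1 : ∀ a → a * n ≤ suc e → ℕ→ℚ a ℚ.* δ ℚ.≤ 1ℚ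
    scaled≤1 a a·n≤ = toℚᵘ-cancel-≤ (ℚᵘ.≤-respˡ-≃ (ℚᵘ.≃-sym (toℚᵘ-homo-* (ℕ→ℚ a) δ)) unnormalised)
      where
      unnormalised : toℚᵘ (ℕ→ℚ a) ℚᵘ.* toℚᵘ δ ℚᵘ.≤ toℚᵘ 1ℚ
      unnormalised rewrite ℕ→ℚ-toℚᵘ a = ℚᵘ.*≤* cross
        where
        cross : (ℤ.+ a ℤ.* ℤ.+ n) ℤ.* ℤ.+ 1 ℤ.≤ ℤ.+ 1 ℤ.* ℤ.+ suc (e + 0)
        cross rewrite ℤ.*-identityʳ (ℤ.+ a ℤ.* ℤ.+ n) | ℤ.*-identityˡ (ℤ.+ suc (e + 0)) | +-identityʳ e
                    | sym (ℤ.pos-* a n) = ℤ.+≤+ a·n≤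

    1≤scaled : ∀ a → suc e ≤ a * n → 1ℚ ℚ.≤ ℕ→ℚ a ℚ.* δ
    1≤scaled a ≤a·n = toℚᵘ-cancel-≤ (ℚᵘ.≤-respʳ-≃ (ℚᵘ.≃-sym (toℚᵘ-homo-* (ℕ→ℚ a) δ)) unnormalised)
      where
      unnormalised : toℚᵘ 1ℚ ℚᵘ.≤ toℚᵘ (ℕ→ℚ a) ℚᵘ.* toℚᵘ δ
      unnormalised rewrite ℕ→ℚ-toℚᵘ a = ℚᵘ.*≤* cross
        where
        cross : ℤ.+ 1 ℤ.* ℤ.+ suc (e + 0) ℤ.≤ (ℤ.+ a ℤ.* ℤ.+ n) ℤ.* ℤ.+ 1
        cross rewrite ℤ.*-identityʳ (ℤ.+ a ℤ.* ℤ.+ n) | ℤ.*-identityˡ (ℤ.+ suc (e + 0)) | +-identityʳ e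
                    | sym (ℤ.pos-* a n) = ℤ.+≤+ ≤a·n

    below-unit-fraction : ∀ e₀ .(c₀ : Coprime 1 (suc e₀)) → δ ℚ.< mkℚ (ℤ.+ 1) e₀ c₀ → n * suc e₀ < suc e
    below-unit-fraction e₀ c₀ (ℚ.*<* cross) =
      ℤ.drop‿+<+ (subst₂ ℤ._<_ (sym (ℤ.pos-* n (suc e₀))) (ℤ.*-identityˡ (ℤ.+ suc e)) cross)

  -- Every interval [2ᴸ·a, ∞) containing E has a dyadic scale L' ≥ L with
  -- 2^{L'}·a ≤ E < 2^{L'+1}·a; the search ends within E steps because L' < 2^{L'}.
  dyadic-scale : ∀ a E fuel L → E ≤ L + fuel → 2 ^ L * suc a ≤ E →
                 ∃[ L' ] (L ≤ L' × 2 ^ L' * suc a ≤ E × E < 2 ^ suc L' * suc a)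
  dyadic-scale a E fuel L E≤ 2ᴸa≤E with E <? 2 ^ suc L * suc a
  ... | yes E< = L , ≤-refl , 2ᴸa≤E , E<
  dyadic-scale a E zero L E≤ 2ᴸa≤E | no _ = ⊥-elim (<-irrefl refl (<-≤-trans (n<2^n L)
    (≤-trans (m≤m*n (2 ^ L) (suc a)) (≤-trans 2ᴸa≤E (≤-trans E≤ (≤-reflexive (+-identityʳ L)))))))
  dyadic-scale a E (suc fuel) L E≤ 2ᴸa≤E | no E≮ =
    let (L' , L<L' , below , above) = dyadic-scale a E fuel (suc L) (≤-trans E≤ (≤-reflexive (+-suc L fuel))) (≮⇒≥ E≮)
    in L' , <⇒≤ L<L' , below , above

  -- The four properties of the theorem at density δ, for β = 1/c (that is, b = 1).
  DensityGraph : (h c : ℕ) → ℚ → Set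
  DensityGraph h c δ = ∃[ N ] Σ (Graph N) λ R → Σ (Fin N → Fin h) λ part →
    (∀ u v → part u ≡ part v → adj R u v ≡ false) ×
    (∀ (p q : ℕ) → 1 ≤ q → (ℕ→ℚ 2 ^ℚ (p * c)) ℚ.* (δ ^ℚ (q * 1)) ℚ.< 1ℚ → 1ℚ ℚ.≤ (ℕ→ℚ N ^ℚ q) ℚ.* (δ ^ℚ p)) ×
    (∃[ m ] Σ (Fin m → Fin h → Fin N) λ K →
       IsEdgeDisjointCliqueDecomposition R h m K × δ ℚ.* ℕ→ℚ (N * N) ℚ.≤ ℕ→ℚ m) ×
    ((t : ℕ) → 3 ≤ t → t ≤ h → (s : Fin t → Fin h) → StrictlyIncreasing s → cycleCount R part t s ≤ N * N)

  clique-density : ∀ {δ N m L} → 0ℚ ℚ.≤ δ → ℕ→ℚ (2 ^ L) ℚ.* δ ℚ.≤ 1ℚ → N * N ≤ 2 ^ L * m →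
                   δ ℚ.* ℕ→ℚ (N * N) ℚ.≤ ℕ→ℚ m
  clique-density {δ} {N} {m} {L} 0≤δ 2ᴸδ≤1 N²≤ = begin
    δ ℚ.* ℕ→ℚ (N * N)                    ≤⟨ ℚ-*-monoˡ-≤ δ 0≤δ (ℕ→ℚ-mono N²≤) ⟩
    δ ℚ.* ℕ→ℚ (2 ^ L * m)                ≡⟨ cong (δ ℚ.*_) (ℕ→ℚ-* (2 ^ L) m) ⟩
    δ ℚ.* (ℕ→ℚ (2 ^ L) ℚ.* ℕ→ℚ m)        ≡⟨ ℚ.*-assoc δ (ℕ→ℚ (2 ^ L)) (ℕ→ℚ m) ⟨
    δ ℚ.* ℕ→ℚ (2 ^ L) ℚ.* ℕ→ℚ m          ≡⟨ cong (ℚ._* ℕ→ℚ m) (ℚ.*-comm δ (ℕ→ℚ (2 ^ L))) ⟩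
    ℕ→ℚ (2 ^ L) ℚ.* δ ℚ.* ℕ→ℚ m          ≤⟨ ℚ-*-monoʳ-≤ (ℕ→ℚ m) (ℕ→ℚ-nonNeg m) 2ᴸδ≤1 ⟩
    1ℚ ℚ.* ℕ→ℚ m                         ≡⟨ ℚ.*-identityˡ (ℕ→ℚ m) ⟩
    ℕ→ℚ m                                ∎
    where open ℚ.≤-Reasoning

  scaled-power : ∀ L δ k → ℕ→ℚ (2 ^ (suc L * k)) ℚ.* δ ^ℚ k ≡ (ℕ→ℚ (2 ^ suc L) ℚ.* δ) ^ℚ k
  scaled-power L δ k = begin
    ℕ→ℚ (2 ^ (suc L * k)) ℚ.* δ ^ℚ k       ≡⟨ cong (λ z → ℕ→ℚ z ℚ.* δ ^ℚ k) (^-*-assoc 2 (suc L) k) ⟨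
    ℕ→ℚ ((2 ^ suc L) ^ k) ℚ.* δ ^ℚ k       ≡⟨ cong (ℚ._* δ ^ℚ k) (ℕ→ℚ-^ (2 ^ suc L) k) ⟩
    ℕ→ℚ (2 ^ suc L) ^ℚ k ℚ.* δ ^ℚ k        ≡⟨ ^ℚ-distrib-* (ℕ→ℚ (2 ^ suc L)) δ k ⟨
    (ℕ→ℚ (2 ^ suc L) ℚ.* δ) ^ℚ k           ∎
    where open ≡-Reasoning

  power-lower : ∀ {δ L} a k → 0ℚ ℚ.≤ δ → 1ℚ ℚ.≤ ℕ→ℚ (2 ^ suc L) ℚ.* δ → suc L * k ≤ a →
                1ℚ ℚ.≤ ℕ→ℚ (2 ^ a) ℚ.* δ ^ℚ k
  power-lower {δ} {L} a k 0≤δ 1≤2δ ≤a = begin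
    1ℚ                                   ≤⟨ 1≤^ℚ _ k 1≤2δ ⟩
    (ℕ→ℚ (2 ^ suc L) ℚ.* δ) ^ℚ k         ≡⟨ scaled-power L δ k ⟨
    ℕ→ℚ (2 ^ (suc L * k)) ℚ.* δ ^ℚ k     ≤⟨ ℚ-*-monoʳ-≤ (δ ^ℚ k) (^ℚ-nonNeg δ k 0≤δ) (ℕ→ℚ-mono (^-monoʳ-≤ 2 ≤a)) ⟩
    ℕ→ℚ (2 ^ a) ℚ.* δ ^ℚ k               ∎
    where open ℚ.≤-Reasoning

  -- Since 2ᵃ·δᵏ < 1 ≤ 2^{(L+1)k}·δᵏ whenever (L+1)k ≤ a, a small power 2ᵃ·δᵏ forces a < (L+1)k.
  exponent-below : ∀ {δ L} a k → 0ℚ ℚ.≤ δ → 1ℚ ℚ.≤ ℕ→ℚ (2 ^ suc L) ℚ.* δ →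
                   (ℕ→ℚ 2 ^ℚ a) ℚ.* (δ ^ℚ k) ℚ.< 1ℚ → a < suc L * k
  exponent-below {δ} {L} a k 0≤δ 1≤2δ small with suc L * k ≤? a
  ... | no ≰ = ≰⇒> ≰
  ... | yes ≤a = ⊥-elim (ℚ.<-irrefl refl (ℚ.≤-<-trans
        (subst (1ℚ ℚ.≤_) (cong (ℚ._* δ ^ℚ k) (ℕ→ℚ-^ 2 a)) (power-lower {δ} {L} a k 0≤δ 1≤2δ ≤a)) small))

  -- From pc < (L+1)q and (L+1)² ≤ cE: c·(L+1)p < (L+1)²q ≤ c·Eq, so (L+1)p ≤ Eq.
  exponent-transfer : ∀ {p q c L E} → p * c < suc L * (q * 1) → suc L * suc L ≤ c * E → suc L * p ≤ E * q
  exponent-transfer {p} {q} {c} {L} {E} pc< [L+1]²≤cE = <⇒≤ (*-cancelˡ-< c _ _ (begin-strict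
    c * (suc L * p)            ≡⟨ swap c (suc L) p ⟩
    suc L * (p * c)            <⟨ *-monoʳ-< (suc L) pc< ⟩
    suc L * (suc L * (q * 1))  ≡⟨ square (suc L) q ⟩
    suc L * suc L * q          ≤⟨ *-monoˡ-≤ q [L+1]²≤cE ⟩
    c * E * q                  ≡⟨ *-assoc c E q ⟩
    c * (E * q)                ∎))
    where
    open ≤-Reasoning
    swap : ∀ c l p → c * (l * p) ≡ l * (p * c)
    swap = solve-∀
    square : ∀ l q → l * (l * (q * 1)) ≡ l * l * q
    square = solve-∀

  -- (2) at density δ: if 2^{L+1}·δ ≥ 1, N ≥ 2ᴱ and (L+1)² ≤ c·E, then
  -- N^q·δ^p ≥ 1 whenever 2^{pc}·δ^q < 1, i.e. N ≥ (1/δ)^{log₂(1/δ)/c}.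
  size-property : ∀ {δ N L E c} → 0ℚ ℚ.≤ δ → 1ℚ ℚ.≤ ℕ→ℚ (2 ^ suc L) ℚ.* δ → 2 ^ E ≤ N → suc L * suc L ≤ c * E →
    ∀ p q → (ℕ→ℚ 2 ^ℚ (p * c)) ℚ.* (δ ^ℚ (q * 1)) ℚ.< 1ℚ → 1ℚ ℚ.≤ (ℕ→ℚ N ^ℚ q) ℚ.* (δ ^ℚ p)
  size-property {δ} {N} {L} {E} {c} 0≤δ 1≤2δ 2ᴱ≤N [L+1]²≤cE p q small = begin
    1ℚ                                   ≤⟨ power-lower {δ} {L} (suc L * p) p 0≤δ 1≤2δ ≤-refl ⟩
    ℕ→ℚ (2 ^ (suc L * p)) ℚ.* δ ^ℚ p     ≤⟨ ℚ-*-monoʳ-≤ (δ ^ℚ p) (^ℚ-nonNeg δ p 0≤δ) (ℕ→ℚ-mono 2^[L+1]p≤N^q) ⟩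
    ℕ→ℚ (N ^ q) ℚ.* δ ^ℚ p               ≡⟨ cong (ℚ._* δ ^ℚ p) (ℕ→ℚ-^ N q) ⟩
    ℕ→ℚ N ^ℚ q ℚ.* δ ^ℚ p                ∎
    where
    open ℚ.≤-Reasoning
    [L+1]p≤Eq : suc L * p ≤ E * q
    [L+1]p≤Eq = exponent-transfer {p} {q} {c} {L} {E} (exponent-below {δ} {L} (p * c) (q * 1) 0≤δ 1≤2δ small) [L+1]²≤cE
    2^[L+1]p≤N^q : 2 ^ (suc L * p) ≤ N ^ q
    2^[L+1]p≤N^q = ≤-trans (^-monoʳ-≤ 2 [L+1]p≤Eq) (subst (_≤ N ^ q) (^-*-assoc 2 E q) (^-monoˡ-≤ q 2ᴱ≤N))

  -- Below δ₀ = 2^{-L₀}, every density lies at some scale L ≥ L₀, so graphs at all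
  -- scales L ≥ L₀ give graphs at all densities δ < δ₀.
  module AtDensity (h c L₀ : ℕ) (scales : ∀ L → L₀ ≤ L → GraphAtScale h c L) where

    δ₀ : ℚ
    δ₀ = mkℚ (ℤ.+ 1) (ℕ.pred (2 ^ L₀)) (1-coprimeTo _)

    from-scale : ∀ {δ L} → 0ℚ ℚ.≤ δ → ℕ→ℚ (2 ^ L) ℚ.* δ ℚ.≤ 1ℚ → 1ℚ ℚ.≤ ℕ→ℚ (2 ^ suc L) ℚ.* δ →
                 GraphAtScale h c L → DensityGraph h c δ
    from-scale {δ} {L} 0≤δ 2ᴸδ≤1 1≤2δ (N , R , part , independent , (m , K , decomposition , N²≤) , cycles , (E , 2ᴱ≤N , [L+1]²≤cE)) =
      N , R , part , independent , (λ p q _ → size-property {δ} {N} {L} {E} {c} 0≤δ 1≤2δ 2ᴱ≤N [L+1]²≤cE p q) ,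
      (m , K , decomposition , clique-density {δ} {N} {m} {L} 0≤δ 2ᴸδ≤1 N²≤) , cycles

    graph-at-density : (δ : ℚ) → Positive δ → δ ℚ.< δ₀ → DensityGraph h c δ
    graph-at-density (mkℚ (ℤ.+ suc n) e coprime) _ δ<δ₀ =
      let (L , L₀≤L , 2ᴸn≤ , <2ᴸ⁺¹n) = dyadic-scale n (suc e) (suc e) L₀ (m≤n+m (suc e) L₀) 2^L₀n≤
      in from-scale {L = L} (ℚ.nonNegative⁻¹ δ) (scaled≤1 (2 ^ L) 2ᴸn≤) (1≤scaled (2 ^ suc L) (<⇒≤ <2ᴸ⁺¹n)) (scales L L₀≤L)
      where
      open Fraction (suc n) e coprime using (δ; scaled≤1; 1≤scaled; below-unit-fraction)
      2^L₀n≤ : 2 ^ L₀ * suc n ≤ suc e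
      2^L₀n≤ = <⇒≤ (subst (_< suc e) (trans (cong (suc n *_) (suc-pred (2 ^ L₀) {{m^n≢0 2 L₀}})) (*-comm (suc n) (2 ^ L₀)))
                         (below-unit-fraction (ℕ.pred (2 ^ L₀)) (1-coprimeTo _) δ<δ₀))

open import Defs hiding (sym)
open import Data.Nat using (ℕ; suc; _≤_; _<_)
open import Data.Fin using (Fin)
open import Data.Bool using (Bool; true; false)
open import Data.Product using (Σ; ∃; ∃-syntax; _×_)
open import Data.Rational using (ℚ; Positive; 0ℚ; 1ℚ; _*_)
import Data.Rational as Q
open import Relation.Binary.PropositionalEquality using (_≡_; _≢_)
open import Data.Nat using (z≤n; s≤s)
open import Data.Nat.Properties using (≤-refl; ≤-trans)
open import Data.Product using (_,_)
open Development using (threshold; constant; module Scale; module AtDensity)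

lemma3p3 : (h : ℕ) → 3 ≤ h →
    ∃[ δ₀ ] Positive δ₀ × ∃[ b ] ∃[ c ] (1 ≤ b × 1 ≤ c ×
      ((δ : ℚ) → Positive δ → δ Q.< δ₀ →
        ∃[ N ] Σ (Graph N) λ R → Σ (Fin N → Fin h) λ part →
          -- (1) V(R) = V_1 ∪ … ∪ V_h disjoint, each V_i independent
          (∀ u v → part u ≡ part v → adj R u v ≡ false) ×
          -- (2) |V(R)| ≥ (1/δ)^(β log₂(1/δ)) with β = b/c, written via rational exponents p/q
          (∀ (p q : ℕ) → 1 ≤ q →
             (ℕ→ℚ 2 ^ℚ (p Data.Nat.* c)) * (δ ^ℚ (q Data.Nat.* b)) Q.< 1ℚ →
             1ℚ Q.≤ (ℕ→ℚ N ^ℚ q) * (δ ^ℚ p)) ×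
          -- (3) E(R) is the union of m ≥ δ|V(R)|² pairwise edge-disjoint h-cliques
          (∃[ m ] Σ (Fin m → Fin h → Fin N) λ K →
             IsEdgeDisjointCliqueDecomposition R h m K × δ * ℕ→ℚ (N Data.Nat.* N) Q.≤ ℕ→ℚ m) ×
          -- (4) few cycles through any increasing sequence of parts
          ((t : ℕ) → 3 ≤ t → t ≤ h → (s : Fin t → Fin h) → StrictlyIncreasing s →
             cycleCount R part t s ≤ N Data.Nat.* N)))
lemma3p3 h h≥3 = δ₀ , _ , 1 , constant h , ≤-refl , s≤s z≤n , graph-at-density
  where open AtDensity h (constant h) (threshold h) (Scale.graph-at-scale h (≤-trans (s≤s z≤n) h≥3))
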